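{- For any category of FH models $\mathcal{C}(\mathsf{K}_{\mathsf{At}}) = \langle (\mathsf{K}_{\Phi})_{\Phi \subseteq \mathsf{At}}, (f^{\Phi}_{\Psi})_{\Psi \subseteq \Phi \subseteq \mathsf{At}} \rangle$, its $T$-transform $T(\mathcal{C}(\mathsf{K}_{\mathsf{At}}))$ is an implicit knowledge-based HMS model.
   Context: Fix a nonempty set $\mathsf{At}$ of atoms and a nonempty set $I$ of agents. Language: $\varphi ::= \top \mid p \mid \neg\varphi \mid \varphi \wedge \psi \mid \ell_i\varphi \mid a_i\varphi \mid k_i\varphi$; $\mathsf{At}(\varphi)$ is the set of atoms in $\varphi$, for a set $X$ of formulas $\mathsf{At}(X) := \bigcup_{\varphi \in X}\mathsf{At}(\varphi)$, and $\mathcal{L}_\Phi := \{\varphi : \mathsf{At}(\varphi) \subseteq \Phi\}$. FH model for $\Phi \subseteq \mathsf{At}$: $\mathsf{K}_\Phi = \langle I, W_\Phi, (R_{\Phi,i}), (\mathcal{A}_{\Phi,i}), V_\Phi\rangle$ with $W_\Phi$ nonempty, $R_{\Phi,i}$ equivalence relations on $W_\Phi$, $\mathcal{A}_{\Phi,i}: W_\Phi \to 2^{\mathcal{L}_\Phi}$ with $\varphi \in \mathcal{A}_{\Phi,i}(w)$ iff $\mathsf{At}(\varphi) \subseteq \mathcal{A}_{\Phi,i}(w)$, and $(w,t) \in R_{\Phi,i} \Rightarrow \mathcal{A}_{\Phi,i}(w) = \mathcal{A}_{\Phi,i}(t)$; $V_\Phi : \Phi \to 2^{W_\Phi}$. A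 surjective bounded morphism $f^\Phi_\Psi$ ($\Psi \subseteq \Phi$) is a surjection $W_\Phi \to W_\Psi$ with: for $p \in \Psi$, $w \in V_\Phi(p)$ iff $f^\Phi_\Psi(w) \in V_\Psi(p)$; $\mathcal{A}_{\Phi,i}(w) \cap \mathcal{L}_\Psi = \mathcal{A}_{\Psi,i}(f^\Phi_\Psi(w))$; $(w,t) \in R_{\Phi,i} \Rightarrow (f^\Phi_\Psi(w), f^\Phi_\Psi(t)) \in R_{\Psi,i}$; if $(f^\Phi_\Psi(w), t') \in R_{\Psi,i}$ then some $t$ has $f^\Phi_\Psi(t) = t'$ and $(w,t) \in R_{\Phi,i}$. A category of FH models consists of FH models $\mathsf{K}_\Phi$ for all $\Phi \subseteq \mathsf{At}$ (with top object $\mathsf{K}_{\mathsf{At}}$) and surjective bounded morphisms $f^\Phi_\Psi$ for all $\Psi \subseteq \Phi$, with $f^\Phi_\Phi$ the identity and $f^\Phi_\Upsilon = f^\Psi_\Upsilon \circ f^\Phi_\Psi$. The $T$-transform is $\langle I, \{S_\Phi\}, (r^\Phi_\Psi), (\Lambda^*_i), (\alpha_i), v\rangle$ with $S_\Phi := W_\Phi$ (taken pairwise disjoint), $\Omega := \bigcup_\Phi S_\Phi$, $r^\Phi_\Psi := f^\Phi_\Psi$; for $w \in S_\Phi$, $w' \in \Lambda^*_i(w)$ iff $(w,w') \in R_{\Phi,i}$; for $w \in S_\Psi$, $\alpha_i(w) := S_\Upsilon$ where $\Upsilon = \mathsf{At}(\mathcal{A}_{\Psi,i}(w))$; and $v(p)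 := \bigcup_{\Phi \ni p} V_\Phi(p)$. Implicit knowledge-based HMS model: with $S_\Psi \preceq S_\Phi$ iff $\Psi \subseteq \Phi$, $\omega_\Psi := r^\Phi_\Psi(\omega)$ for $\omega\in S_\Phi$, $D_\Psi := r^\Phi_\Psi(D)$, $D^\uparrow := \bigcup_{\Phi \subseteq \Psi}(r^\Psi_\Phi)^{ -1}(D)$ for $D \subseteq S_\Phi$, and events the sets $D^\uparrow$: a tuple $\langle I, \{S_\Phi\}_{\Phi \subseteq \mathsf{At}}, (r^\Phi_\Psi), (\Lambda^*_i), (\alpha_i), v\rangle$ where the $S_\Phi$ are nonempty pairwise disjoint, the $r^\Phi_\Psi: S_\Phi \to S_\Psi$ are surjections with $r^\Phi_\Phi$ the identity and $r^\Phi_\Upsilon = r^\Psi_\Upsilon \circ r^\Phi_\Psi$, $v$ maps atoms to events, $\Lambda^*_i : \Omega \to 2^\Omega\setminus\{\emptyset\}$ satisfies Reflexivity ($\omega \in \Lambda^*_i(\omega)$), Stationarity ($\omega' \in \Lambda^*_i(\omega) \Rightarrow \Lambda^*_i(\omega') = \Lambda^*_i(\omega)$), Projections Preserve Implicit Knowledge ($\omega \in S_\Phi \Rightarrow \Lambda^*_i(\omega)_\Psi = \Lambda^*_i(\omega_\Psi)$ for all $\Psi \subseteq \Phi$), and $\alpha_i : \Omega \to \{S_\Phi\}$ satisfies: O. $\omega \in S_\Phi \Rightarrow \alpha_i(\omega) \preceq S_\Phi$; I. $\omega' \in \Lambda^*_i(\omega) \Rightarrow \alpha_i(\omega') = \alpha_i(\omega)$;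 II. $\omega \in S_\Phi$, $S_\Psi \preceq \alpha_i(\omega) \Rightarrow \alpha_i(\omega_\Psi) = S_\Psi$; III. $\omega \in S_\Phi$, $\alpha_i(\omega) \preceq S_\Psi \preceq S_\Phi \Rightarrow \alpha_i(\omega_\Psi) = \alpha_i(\omega)$; IV. $\omega \in S_\Phi$, $\Psi \subseteq \Phi \Rightarrow \alpha_i(\omega) \succeq \alpha_i(\omega_\Psi)$. -}

module Defs where

open import Level using (Lift)
open import Data.Product using (Σ; ∃; _×_; _,_)
open import Data.Sum using (_⊎_)
open import Data.Empty using (⊥)
open import Relation.Binary.PropositionalEquality using (_≡_)
open import Relation.Binary.Structures using (IsEquivalence)

Subset : Set → Set₁
Subset A = A → Set

-- inclusion (proof relevant; all constructions below quantify over
-- every inclusion proof)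
_⊆ˢ_ : {A : Set} → Subset A → Subset A → Set
P ⊆ˢ Q = ∀ a → P a → Q a

_≐_ : {A : Set} → Subset A → Subset A → Set
P ≐ Q = (P ⊆ˢ Q) × (Q ⊆ˢ P)

_⟺_ : ∀ {a b} → Set a → Set b → Set _
P ⟺ Q = (P → Q) × (Q → P)

data Form (At I : Set) : Set where
  ⊤ᶠ   : Form At I
  atom : At → Form At I
  ¬ᶠ   : Form At I → Form At I
  _∧ᶠ_ : Form At I → Form At I → Form At I
  ℓ    : I → Form At I → Form At I
  a    : I → Form At I → Form At I
  k    : I → Form At I → Form At I

_∈At_ : {At I : Set} → At → Form At I → Set
p ∈At ⊤ᶠ       = ⊥
p ∈At atom q   = p ≡ q
p ∈At ¬ᶠ φ     = p ∈At φ
p ∈At (φ ∧ᶠ ψ) = p ∈At φ ⊎ p ∈At ψ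
p ∈At ℓ i φ    = p ∈At φ
p ∈At a i φ    = p ∈At φ
p ∈At k i φ    = p ∈At φ

atoms : {At I : Set} → Form At I → Subset At
atoms φ p = p ∈At φ

atomsOf : {At I : Set} → Subset (Form At I) → Subset At
atomsOf X p = Σ _ λ φ → X φ × p ∈At φ

record FHModel (At I : Set) (Φ : Subset At) : Set₁ where
  field
    W      : Set
    w₀     : W                                   -- W nonempty
    R      : I → W → W → Set
    R-equiv : ∀ i → IsEquivalence (R i)
    𝒜      : I → W → Subset (Form At I)
    𝒜-lang : ∀ i w φ → 𝒜 i w φ → atoms φ ⊆ˢ Φ
    𝒜-gen  : ∀ i w φ → 𝒜 i w φ ⟺ (∀ p → p ∈At φ → 𝒜 i w (atom p))
    𝒜-R    : ∀ i w t → R i w t → 𝒜 i w ≐ 𝒜 i t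
    -- valuation; only its values on atoms p ∈ Φ are ever used
    V      : At → Subset W

open FHModel

record IsSurjBoundedMorphism {At I : Set} {Φ Ψ : Subset At}
         (KΦ : FHModel At I Φ) (KΨ : FHModel At I Ψ)
         (f : W KΦ → W KΨ) : Set where
  field
    surj  : ∀ y → ∃ λ x → f x ≡ y
    val   : ∀ p → Ψ p → ∀ w → V KΦ p w ⟺ V KΨ p (f w)
    aware : ∀ i w φ → (𝒜 KΦ i w φ × atoms φ ⊆ˢ Ψ) ⟺ 𝒜 KΨ i (f w) φ
    forth : ∀ i w t → R KΦ i w t → R KΨ i (f w) (f t)
    back  : ∀ i w t′ → R KΨ i (f w) t′ → ∃ λ t → f t ≡ t′ × R KΦ i w t

record FHCategory (At I : Set) : Set₁ where
  field
    K      : (Φ : Subset At) → FHModel At I Φ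
    f      : ∀ {Φ Ψ} → Ψ ⊆ˢ Φ → W (K Φ) → W (K Ψ)
    f-morph : ∀ {Φ Ψ} (s : Ψ ⊆ˢ Φ) → IsSurjBoundedMorphism (K Φ) (K Ψ) (f s)
    f-id   : ∀ {Φ} (s : Φ ⊆ˢ Φ) w → f s w ≡ w
    f-comp : ∀ {Φ Ψ Υ} (s : Υ ⊆ˢ Φ) (s₁ : Ψ ⊆ˢ Φ) (s₂ : Υ ⊆ˢ Ψ) w →
             f s w ≡ f s₂ (f s₁ w)

-- HMS structures.  S Φ is the space S_Φ; Ω is the disjoint union
-- Σ Φ, S Φ (so the S_Φ are pairwise disjoint by construction);
-- α i ω = Υ encodes α_i(ω) = S_Υ, and S_Ψ ⪯ S_Φ is Ψ ⊆ Φ.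

record HMS (At I : Set) : Set₂ where
  field
    S : Subset At → Set
    r : ∀ {Φ Ψ} → Ψ ⊆ˢ Φ → S Φ → S Ψ
    Λ : I → Σ (Subset At) S → Σ (Subset At) S → Set₁   -- ω′ ∈ Λ* i ω
    α : I → Σ (Subset At) S → Subset At
    v : At → Σ (Subset At) S → Set₁

module _ {At I : Set} (M : HMS At I) where
  open HMS M

  Ω : Set₁
  Ω = Σ (Subset At) S

  up : ∀ {Φ} → (S Φ → Set₁) → Ω → Set₁
  up {Φ} D (Ψ , x) = Σ (Φ ⊆ˢ Ψ) λ s → D (r s x)

  IsEvent : (Ω → Set₁) → Set₂
  IsEvent E = Σ (Subset At) λ Φ → Σ (S Φ → Set₁) λ D → ∀ ω → E ω ⟺ up D ω

  -- E_Ψ := r^Φ_Ψ(E) for E ⊆ S_Φ (taking the part of E lying in S_Φ)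
  proj : ∀ {Φ Ψ} → Ψ ⊆ˢ Φ → (Ω → Set₁) → Ω → Set₁
  proj {Φ} {Ψ} s E ω″ = Σ (S Φ) λ x → E (Φ , x) × ω″ ≡ (Ψ , r s x)

  record IsImplicitHMS : Set₂ where
    field
      S-nonempty : ∀ Φ → S Φ
      r-surj  : ∀ {Φ Ψ} (s : Ψ ⊆ˢ Φ) y → ∃ λ x → r s x ≡ y
      r-id    : ∀ {Φ} (s : Φ ⊆ˢ Φ) x → r s x ≡ x
      r-comp  : ∀ {Φ Ψ Υ} (s : Υ ⊆ˢ Φ) (s₁ : Ψ ⊆ˢ Φ) (s₂ : Υ ⊆ˢ Ψ) x →
                r s x ≡ r s₂ (r s₁ x)
      v-event : ∀ p → IsEvent (v p)
      Λ-nonempty : ∀ i ω → Σ Ω (Λ i ω)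
      reflexivity  : ∀ i ω → Λ i ω ω
      stationarity : ∀ i ω ω′ → Λ i ω ω′ → ∀ ω″ → Λ i ω′ ω″ ⟺ Λ i ω ω″
      ppik : ∀ i {Φ Ψ} (x : S Φ) (s : Ψ ⊆ˢ Φ) ω″ →
             proj s (Λ i (Φ , x)) ω″ ⟺ Λ i (Ψ , r s x) ω″
      condO   : ∀ i {Φ} (x : S Φ) → α i (Φ , x) ⊆ˢ Φ
      condI   : ∀ i ω ω′ → Λ i ω ω′ → α i ω′ ≐ α i ω
      condII  : ∀ i {Φ Ψ} (x : S Φ) (s : Ψ ⊆ˢ Φ) →
                Ψ ⊆ˢ α i (Φ , x) → α i (Ψ , r s x) ≐ Ψ
      condIII : ∀ i {Φ Ψ} (x : S Φ) (s : Ψ ⊆ˢ Φ) →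
                α i (Φ , x) ⊆ˢ Ψ → α i (Ψ , r s x) ≐ α i (Φ , x)
      condIV  : ∀ i {Φ Ψ} (x : S Φ) (s : Ψ ⊆ˢ Φ) →
                α i (Ψ , r s x) ⊆ˢ α i (Φ , x)

module _ {At I : Set} (C : FHCategory At I) where
  open FHCategory C

  data TΛ (i : I) : Σ (Subset At) (λ Φ → W (K Φ)) →
                    Σ (Subset At) (λ Φ → W (K Φ)) → Set₁ where
    mk : ∀ {Φ} {w w′ : W (K Φ)} → R (K Φ) i w w′ → TΛ i (Φ , w) (Φ , w′)

  Tα : I → Σ (Subset At) (λ Φ → W (K Φ)) → Subset At
  Tα i (Ψ , w) = atomsOf (𝒜 (K Ψ) i w)

  Tv : At → Σ (Subset At) (λ Φ → W (K Φ)) → Set₁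
  Tv p (Φ , w) = Lift _ (Φ p × V (K Φ) p w)

  T : HMS At I
  T = record
    { S = λ Φ → W (K Φ)
    ; r = f
    ; Λ = TΛ
    ; α = Tα
    ; v = Tv
    }

{-# OPTIONS --safe #-}
-- The awareness of a world of K_Ψ is the awareness of any preimage in K_Φ
-- restricted to L_Ψ, and awareness sets are generated by their atoms; so the
-- atoms an agent is aware of at f(w) are exactly those at w that lie in Ψ.
-- Conditions O–IV all follow from this one description of α_i under
-- projection.  Λ*_i is R_{Φ,i} on each S_Φ, so Reflexivity and Stationarity
-- come from R being an equivalence, and Projections Preserve Implicit
-- Knowledge is precisely the forth and back conditions.
module Submission where

open import Defs
open import Level using (Lift; lift)
open import Data.Product using (_×_; _,_; proj₁; proj₂; swap)
open import Function using (_∘_)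
open import Relation.Binary.PropositionalEquality using (_≡_; refl)
open import Relation.Binary.Structures using (IsEquivalence)

stationary : ∀ {a ℓ} {A : Set a} {_∼_ : A → A → Set ℓ} →
             IsEquivalence _∼_ → ∀ {x y} → x ∼ y → ∀ z → (y ∼ z) ⟺ (x ∼ z)
stationary eq x∼y z = IsEquivalence.trans eq x∼y , IsEquivalence.trans eq (IsEquivalence.sym eq x∼y)

atomsOf-cong : {At I : Set} {X Y : Subset (Form At I)} → X ≐ Y → atomsOf X ≐ atomsOf Y
atomsOf-cong (X⊆Y , Y⊆X) = (λ { p (φ , Xφ , pφ) → φ , X⊆Y φ Xφ , pφ })
                         , (λ { p (φ , Yφ , pφ) → φ , Y⊆X φ Yφ , pφ })

module _ {At I : Set} where
  open FHModel

  module _ {Φ : Subset At} (M : FHModel At I Φ) (i : I) (w : W M) where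

    atomsOf-𝒜⊆ : atomsOf (𝒜 M i w) ⊆ˢ Φ
    atomsOf-𝒜⊆ p (φ , aφ , pφ) = 𝒜-lang M i w φ aφ p pφ

    atomsOf-𝒜⇒atom∈𝒜 : ∀ p → atomsOf (𝒜 M i w) p → 𝒜 M i w (atom p)
    atomsOf-𝒜⇒atom∈𝒜 p (φ , aφ , pφ) = proj₁ (𝒜-gen M i w φ) aφ p pφ

  atomsOf-𝒜-morphism : ∀ {Φ Ψ} {KΦ : FHModel At I Φ} {KΨ : FHModel At I Ψ}
    {g : W KΦ → W KΨ} → IsSurjBoundedMorphism KΦ KΨ g → ∀ i w p →
    atomsOf (𝒜 KΨ i (g w)) p ⟺ (atomsOf (𝒜 KΦ i w) p × Ψ p)
  atomsOf-𝒜-morphism {Ψ = Ψ} {KΦ} {KΨ} {g} m i w p = to , from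
    where
    open IsSurjBoundedMorphism m

    to : atomsOf (𝒜 KΨ i (g w)) p → atomsOf (𝒜 KΦ i w) p × Ψ p
    to (φ , aφ , pφ) with proj₂ (aware i w φ) aφ
    ... | aφ′ , φ⊆Ψ = (φ , aφ′ , pφ) , φ⊆Ψ p pφ

    from : atomsOf (𝒜 KΦ i w) p × Ψ p → atomsOf (𝒜 KΨ i (g w)) p
    from (p∈ , Ψp) = atom p
                   , proj₁ (aware i w (atom p)) (atomsOf-𝒜⇒atom∈𝒜 KΦ i w p p∈ , λ { _ refl → Ψp })
                   , refl

module _ {At I : Set} (C : FHCategory At I) where
  open FHCategory C
  open FHModel
  open IsSurjBoundedMorphism

  TΛ-isEquivalence : ∀ i → IsEquivalence (TΛ C i)
  TΛ-isEquivalence i = record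
    { refl  = λ { {_ , _} → mk refl′ }
    ; sym   = λ { (mk wRt) → mk (sym′ wRt) }
    ; trans = λ { (mk wRt) (mk tRu) → mk (trans′ wRt tRu) }
    }
    where open module R-eq {Φ} = IsEquivalence (R-equiv (K Φ) i)
            renaming (refl to refl′; sym to sym′; trans to trans′)

  Tv-isEvent : ∀ p → IsEvent (T C) (Tv C p)
  Tv-isEvent p = (_≡ p) , Vₚ , λ { (Ψ , w) → to w , from w }
    where
    Vₚ : W (K (_≡ p)) → Set₁
    Vₚ w = Lift _ (V (K (_≡ p)) p w)

    to : ∀ {Ψ} w → Tv C p (Ψ , w) → up (T C) Vₚ (Ψ , w)
    to w (lift (Ψp , Vw)) = (λ { _ refl → Ψp }) , lift (proj₁ (val (f-morph _) p refl w) Vw)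

    from : ∀ {Ψ} w → up (T C) Vₚ (Ψ , w) → Tv C p (Ψ , w)
    from w (s , lift Vfw) = lift (s p refl , proj₂ (val (f-morph s) p refl w) Vfw)

  TΛ-proj : ∀ i {Φ Ψ} (x : W (K Φ)) (s : Ψ ⊆ˢ Φ) ω →
            proj (T C) s (TΛ C i (Φ , x)) ω ⟺ TΛ C i (Ψ , f s x) ω
  TΛ-proj i x s _ = (λ { (t , mk xRt , refl) → mk (forth (f-morph s) i x t xRt) }) , lift-back
    where
    lift-back : ∀ {ω} → TΛ C i (_ , f s x) ω → proj (T C) s (TΛ C i (_ , x)) ω
    lift-back (mk {w′ = t′} fxRt′) with back (f-morph s) i x t′ fxRt′
    ... | t , refl , xRt = t , mk xRt , refl

  Tα-proj : ∀ i {Φ Ψ} (x : W (K Φ)) (s : Ψ ⊆ˢ Φ) p →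
            Tα C i (Ψ , f s x) p ⟺ (Tα C i (Φ , x) p × Ψ p)
  Tα-proj i x s = atomsOf-𝒜-morphism (f-morph s) i x

  T-isImplicitHMS : IsImplicitHMS (T C)
  T-isImplicitHMS = record
    { S-nonempty   = λ Φ → w₀ (K Φ)
    ; r-surj       = λ s → surj (f-morph s)
    ; r-id         = f-id
    ; r-comp       = f-comp
    ; v-event      = Tv-isEvent
    ; Λ-nonempty   = λ i ω → ω , Λ-refl i
    ; reflexivity  = λ i ω → Λ-refl i
    ; stationarity = λ i ω ω′ → stationary (TΛ-isEquivalence i)
    ; ppik         = TΛ-proj
    ; condO        = λ i {Φ} → atomsOf-𝒜⊆ (K Φ) i
    ; condI        = λ { i _ _ (mk {Φ} wRt) → swap (atomsOf-cong (𝒜-R (K Φ) i _ _ wRt)) }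
    ; condII       = λ i x s Ψ⊆α → (λ p → proj₂ ∘ proj₁ (Tα-proj i x s p))
                                   , λ p Ψp → proj₂ (Tα-proj i x s p) (Ψ⊆α p Ψp , Ψp)
    ; condIII      = λ i x s α⊆Ψ → (λ p → proj₁ ∘ proj₁ (Tα-proj i x s p))
                                    , λ p αp → proj₂ (Tα-proj i x s p) (αp , α⊆Ψ p αp)
    ; condIV       = λ i x s p → proj₁ ∘ proj₁ (Tα-proj i x s p)
    }
    where
    Λ-refl : ∀ i {ω} → TΛ C i ω ω
    Λ-refl i = IsEquivalence.refl (TΛ-isEquivalence i)

proposition7 : (At I : Set) → At → I → (C : FHCategory At I) →
    IsImplicitHMS (T C)
proposition7 At I _ _ C = T-isImplicitHMS C
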